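{- Let $\Phi\subseteq\mathrm{GEq}$ and let $(A,d_A)$ be a $\mathbf{GMet}$ space with $\mathrm{Terms}_\Sigma(A)\ne\emptyset$. Then the quantitative algebra $F(A,d_A)$ satisfies every element of $\Phi$, i.e. $F(A,d_A)\in\mathbf{QMod}_\Sigma(\Phi)$.
   Context: Fix a signature $\Sigma$ (operation symbols with finite arities); $\mathrm{Terms}_\Sigma(A)$ is the set of $\Sigma$-terms over a set $A$. A fuzzy relation space is $(A,d_A)$ with $d_A:A\times A\to[0,1]$; $f:(A,d_A)\to(B,d_B)$ is nonexpansive if $d_B(f(a),f(a'))\le d_A(a,a')$. Fix a set $\mathcal H$ of Horn implications $\forall\vec x.(F_1\wedge\dots\wedge F_n\Rightarrow G)$ with atoms $x=y$ or $d(x,y)\le\epsilon$; $\mathbf{GMet}$ is the full subcategory of fuzzy relation spaces (with nonexpansive maps) satisfying $\mathcal H$. A quantitative algebra is $\mathbb A=(A,d_A,\{op^{\mathbb A}\}_{op\in\Sigma})$ with $(A,d_A)$ a $\mathbf{GMet}$ space and arbitrary functions $op^{\mathbb A}:A^{ar(op)}\to A$. For a $\mathbf{GMet}$ space $(X,d_X)$ and nonexpansive $\tau:(X,d_X)\to(A,d_A)$, $[\![\cdot]\!]^{\mathbb A}_\tau:\mathrm{Terms}_\Sigma(X)\to A$ is the homomorphic extension of $\tau$. $\mathrm{GEq}$ is the set of all expressions $\forall(X,d_X).s=t$ and $\forall(X,d_X).s=_\epsilon t$ ($(X,d_X)$ a $\mathbf{GMet}$ space, $s,t\in\mathrm{Terms}_\Sigma(X)$,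 $\epsilon\in[0,1]$); $\mathbb A$ satisfies them iff for every nonexpansive $\tau:(X,d_X)\to(A,d_A)$, $[\![s]\!]_\tau=[\![t]\!]_\tau$, resp. $d_A([\![s]\!]_\tau,[\![t]\!]_\tau)\le\epsilon$. $\mathbf{QMod}_\Sigma(\Phi)$ is the class/category of quantitative algebras satisfying all elements of $\Phi$. The relation $\vdash\subseteq\mathcal P(\mathrm{GEq})\times\mathrm{GEq}$ is the smallest relation closed under (INIT) $\phi\in\Phi\Rightarrow\Phi\vdash\phi$; (CUT) if $\Phi\vdash\phi$ for all $\phi\in\Phi'$ and $\Phi\cup\Phi'\vdash\psi$ then $\Phi\vdash\psi$; (WEAKENING) $\Phi\vdash\phi\Rightarrow\Phi\cup\Phi'\vdash\phi$; and containing all instances (for all $\mathbf{GMet}$ spaces $(A,d_A)$, terms over $A$, $\epsilon,\delta\in[0,1]$) of: (a) $\emptyset\vdash\forall(A,d_A).s=s$; (b) $\{\forall(A,d_A).s=t\}\vdash\forall(A,d_A).t=s$; (c) $\{\forall(A,d_A).s=t,\forall(A,d_A).t=u\}\vdash\forall(A,d_A).s=u$; (d) $\{\forall(A,d_A).s_i=t_i\}_{i\le n}\vdash\forall(A,d_A).op(s_1,..,s_n)=op(t_1,..,t_n)$; (e) for $\sigma:A\to\mathrm{Terms}_\Sigma(B)$ extended to terms and $\Psi=\{\forall(B,d_B).\sigma(a)=_{d_A(a,a')}\sigma(a')\mid a,a'\in A\}$: $\Psi\cup\{\forall(A,d_A).s=t\}\vdash\forall(B,d_B).\sigma(s)=\sigma(t)$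 and $\Psi\cup\{\forall(A,d_A).s=_\epsilon t\}\vdash\forall(B,d_B).\sigma(s)=_\epsilon\sigma(t)$; (f) $\emptyset\vdash\forall(A,d_A).a=_{d_A(a,a')}a'$ for $a,a'\in A$; (g) $\{\forall(A,d_A).s=_\epsilon t\}\vdash\forall(A,d_A).s=_\delta t$ for $\epsilon\le\delta$; (h) $\emptyset\vdash\forall(A,d_A).s=_1t$; (i) $\{\forall(A,d_A).s=_{\epsilon_i}t\}_{i\in I}\vdash\forall(A,d_A).s=_{\inf_i\epsilon_i}t$; (j) $\{\forall(A,d_A).s=t,\forall(A,d_A).t=_\epsilon u\}\vdash\forall(A,d_A).s=_\epsilon u$ and $\{\forall(A,d_A).s=t,\forall(A,d_A).u=_\epsilon s\}\vdash\forall(A,d_A).u=_\epsilon t$; (k) for each implication $\forall X.(F_1\wedge\dots\wedge F_n\Rightarrow G)\in\mathcal H$ and $\sigma:X\to\mathrm{Terms}_\Sigma(A)$, $\{\phi_{F_1},..,\phi_{F_n}\}\vdash\phi_G$, where $\phi_{x=y}$ is $\forall(A,d_A).\sigma(x)=\sigma(y)$ and $\phi_{d(x,y)\le\epsilon}$ is $\forall(A,d_A).\sigma(x)=_\epsilon\sigma(y)$. Construction: for $s,t\in\mathrm{Terms}_\Sigma(A)$ put $s\equiv t$ iff $\Phi\vdash\forall(A,d_A).s=t$, and $d(s,t)=\inf\{\epsilon\in[0,1]\mid\Phi\vdash\forall(A,d_A).s=_\epsilon t\}$. Then $\Delta([s]_\equiv,[t]_\equiv)=d(s,t)$ and $op^{F(A,d_A)}([s_1]_\equiv,\dots,[s_n]_\equiv)=[op(s_1,\dots,s_n)]_\equiv$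 (well defined), and $F(A,d_A)=(\mathrm{Terms}_\Sigma(A)/{\equiv},\Delta,\{op^{F(A,d_A)}\}_{op\in\Sigma})$, which is a quantitative algebra. -}

module Defs where

open import Level using (Level; _⊔_; 0ℓ; Lift) renaming (suc to lsuc)
open import Data.Nat using (ℕ)
open import Data.Fin using (Fin)
open import Data.Empty using (⊥)
open import Data.Product using (Σ; ∃; _×_; _,_; proj₁; proj₂)
open import Data.Sum using (_⊎_; inj₁; inj₂)
open import Data.Rational using (ℚ; 0ℚ; 1ℚ; _<_; _≤_)
open import Data.Rational.Properties using (<-dense; <-trans; <-≤-trans; positive⁻¹)
open import Relation.Binary.PropositionalEquality using (_≡_)

-- A real r ∈ [0,1] is represented by its (rounded) upper Dedekind cut
--   Up q  ⇔  r < q      (q rational).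
-- Classically these records are in bijection with the reals of [0,1]
-- (r = inf of the cut).  The level ℓ only records the universe in which
-- the cut predicate lives (needed because some distances are defined
-- impredicatively, e.g. via derivability).

record UI (ℓ : Level) : Set (lsuc ℓ) where
  field
    Up        : ℚ → Set ℓ
    up-closed : ∀ {p q} → p ≤ q → Up p → Up q
    rounded   : ∀ {q} → Up q → ∃ λ p → p < q × Up p
    ≤one      : ∀ {q} → 1ℚ < q → Up q
    ≥zero     : ∀ {q} → Up q → 0ℚ < q
open UI public

_≼_ : ∀ {a b} → UI a → UI b → Set (a ⊔ b)
r ≼ s = ∀ q → Up s q → Up r q

infix 4 _≼_

one : UI 0ℓ
one = record
  { Up = λ q → 1ℚ < q
  ; up-closed = λ p≤q 1<p → <-≤-trans 1<p p≤q
  ; rounded = λ 1<q → let (m , 1<m , m<q) = <-dense 1<q in m , m<q , 1<m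
  ; ≤one = λ 1<q → 1<q
  ; ≥zero = λ 1<q → <-trans (positive⁻¹ 1ℚ) 1<q
  }

-- infimum in [0,1] of a family (inf of the empty family is 1)
inf : ∀ {i ℓ} {I : Set i} → (I → UI ℓ) → UI (i ⊔ ℓ)
inf {i} {ℓ} {I} f = record
  { Up = λ q → Lift (i ⊔ ℓ) (1ℚ < q) ⊎ ∃ λ (j : I) → Up (f j) q
  ; up-closed = λ { p≤q (inj₁ (Level.lift 1<p)) → inj₁ (Level.lift (<-≤-trans 1<p p≤q))
                  ; p≤q (inj₂ (j , u)) → inj₂ (j , up-closed (f j) p≤q u) }
  ; rounded = λ { (inj₁ (Level.lift 1<q)) → let (m , 1<m , m<q) = <-dense 1<q in m , m<q , inj₁ (Level.lift 1<m)
                ; (inj₂ (j , u)) → let (p , p<q , v) = rounded (f j) u in p , p<q , inj₂ (j , v) }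
  ; ≤one = λ 1<q → inj₁ (Level.lift 1<q)
  ; ≥zero = λ { (inj₁ (Level.lift 1<q)) → <-trans (positive⁻¹ 1ℚ) 1<q
              ; (inj₂ (j , u)) → ≥zero (f j) u }
  }

record Signature : Set₁ where
  field
    Op : Set
    ar : Op → ℕ
open Signature public

data Term (S : Signature) (A : Set) : Set where
  var : A → Term S A
  op  : (o : Op S) → (Fin (ar S o) → Term S A) → Term S A

bind : ∀ {S A B} → (A → Term S B) → Term S A → Term S B
bind σ (var a)   = σ a
bind σ (op o ts) = op o (λ i → bind σ (ts i))

data Atom (m : ℕ) : Set₁ where
  _≐_  : Fin m → Fin m → Atom m
  dle  : Fin m → Fin m → UI 0ℓ → Atom m

record Horn : Set₁ where
  field
    nvars : ℕ
    nprem : ℕ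
    prem  : Fin nprem → Atom nvars
    concl : Atom nvars
open Horn public

-- Fuzzy relation structures, possibly with a carrier taken modulo an
-- equivalence _≈_ (used for quotients such as Terms(A)/≡).
-- A plain fuzzy relation space is one with _≈_ = _≡_.

record FStruct (ℓ : Level) : Set (lsuc ℓ) where
  field
    Carrier : Set
    _≈_     : Carrier → Carrier → Set ℓ
    dist    : Carrier → Carrier → UI ℓ
open FStruct public

plain : (C : Set) → (C → C → UI 0ℓ) → FStruct 0ℓ
plain C d = record { Carrier = C ; _≈_ = _≡_ ; dist = d }

SatAtom : ∀ {ℓ} (S : FStruct ℓ) {m} → (Fin m → Carrier S) → Atom m → Set ℓ
SatAtom S v (x ≐ y)     = _≈_ S (v x) (v y)
SatAtom S v (dle x y ε) = dist S (v x) (v y) ≼ ε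

SatHorn : ∀ {ℓ} (S : FStruct ℓ) → Horn → Set ℓ
SatHorn S h = (v : Fin (nvars h) → Carrier S)
            → (∀ i → SatAtom S v (prem h i)) → SatAtom S v (concl h)

Nonexp : ∀ {a b} (S : FStruct a) (T : FStruct b) → (Carrier S → Carrier T) → Set (a ⊔ b)
Nonexp S T f = ∀ x x' → dist T (f x) (f x') ≼ dist S x x'

module Theory (Sg : Signature) (ℋ : Horn → Set) where

  IsGMet : ∀ {ℓ} → FStruct ℓ → Set (lsuc 0ℓ ⊔ ℓ)
  IsGMet S = ∀ h → ℋ h → SatHorn S h

  record GMetSpace : Set₁ where
    field
      Car   : Set
      d     : Car → Car → UI 0ℓ
      isGMet : IsGMet (plain Car d)
  open GMetSpace public

  spc : GMetSpace → FStruct 0ℓ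
  spc X = plain (Car X) (d X)

  record QAlg (ℓ : Level) : Set (lsuc ℓ) where
    field
      struct : FStruct ℓ
      ops    : (o : Op Sg) → (Fin (ar Sg o) → Carrier struct) → Carrier struct
  open QAlg public

  ⟦_⟧ : ∀ {ℓ} {𝔸 : QAlg ℓ} {X : Set} → Term Sg X → (X → Carrier (struct 𝔸)) → Carrier (struct 𝔸)
  ⟦_⟧ (var x)   τ = τ x
  ⟦_⟧ {𝔸 = 𝔸} (op o ts) τ = ops 𝔸 o (λ i → ⟦_⟧ {𝔸 = 𝔸} (ts i) τ)

  data GEq : Set₁ where
    eqn  : (X : GMetSpace) → Term Sg (Car X) → Term Sg (Car X) → GEq
    deqn : (X : GMetSpace) → Term Sg (Car X) → Term Sg (Car X) → UI 0ℓ → GEq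

  Sat : ∀ {ℓ} → QAlg ℓ → GEq → Set ℓ
  Sat 𝔸 (eqn X s t) = (τ : Car X → Carrier (struct 𝔸)) → Nonexp (spc X) (struct 𝔸) τ
    → _≈_ (struct 𝔸) (⟦_⟧ {𝔸 = 𝔸} s τ) (⟦_⟧ {𝔸 = 𝔸} t τ)
  Sat 𝔸 (deqn X s t ε) = (τ : Car X → Carrier (struct 𝔸)) → Nonexp (spc X) (struct 𝔸) τ
    → dist (struct 𝔸) (⟦_⟧ {𝔸 = 𝔸} s τ) (⟦_⟧ {𝔸 = 𝔸} t τ) ≼ ε

  PSet : Set₂
  PSet = GEq → Set₁

  ∅ : PSet
  ∅ _ = Lift _ ⊥

  ⟨_⟩ : GEq → PSet
  ⟨ e ⟩ g = g ≡ e

  _∪_ : PSet → PSet → PSet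
  (P ∪ Q) g = P g ⊎ Q g

  infixl 6 _∪_

  -- 𝔸 ∈ QMod_Σ(Φ)  (the model-of-Φ part; GMet-ness is IsGMet)
  Models : ∀ {ℓ} → QAlg ℓ → PSet → Set (lsuc 0ℓ ⊔ ℓ)
  Models 𝔸 Φ = ∀ φ → Φ φ → Sat 𝔸 φ

  atomGEq : (A : GMetSpace) {m : ℕ} → (Fin m → Term Sg (Car A)) → Atom m → GEq
  atomGEq A σ (x ≐ y)     = eqn A (σ x) (σ y)
  atomGEq A σ (dle x y ε) = deqn A (σ x) (σ y) ε

  infix 3 _⊢_
  data _⊢_ : PSet → GEq → Set₂ where
    INIT      : ∀ {Φ φ} → Φ φ → Φ ⊢ φ
    CUT       : ∀ {Φ Φ' ψ} → (∀ φ → Φ' φ → Φ ⊢ φ) → Φ ∪ Φ' ⊢ ψ → Φ ⊢ ψ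
    WEAKENING : ∀ {Φ Φ' φ} → Φ ⊢ φ → (∀ g → Φ g → Φ' g) → Φ' ⊢ φ
    ax-refl  : ∀ A s → ∅ ⊢ eqn A s s
    ax-sym   : ∀ A s t → ⟨ eqn A s t ⟩ ⊢ eqn A t s
    ax-trans : ∀ A s t u → ⟨ eqn A s t ⟩ ∪ ⟨ eqn A t u ⟩ ⊢ eqn A s u
    ax-cong  : ∀ A o (ss ts : Fin (ar Sg o) → Term Sg (Car A))
             → (λ g → ∃ λ i → g ≡ eqn A (ss i) (ts i)) ⊢ eqn A (op o ss) (op o ts)
    ax-subst-eq  : ∀ A B (σ : Car A → Term Sg (Car B)) s t
             → (λ g → ∃ λ a → ∃ λ a' → g ≡ deqn B (σ a) (σ a') (d A a a')) ∪ ⟨ eqn A s t ⟩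
               ⊢ eqn B (bind σ s) (bind σ t)
    ax-subst-deq : ∀ A B (σ : Car A → Term Sg (Car B)) s t ε
             → (λ g → ∃ λ a → ∃ λ a' → g ≡ deqn B (σ a) (σ a') (d A a a')) ∪ ⟨ deqn A s t ε ⟩
               ⊢ deqn B (bind σ s) (bind σ t) ε
    ax-dist  : ∀ A a a' → ∅ ⊢ deqn A (var a) (var a') (d A a a')
    ax-mono  : ∀ A s t (ε δ : UI 0ℓ) → ε ≼ δ → ⟨ deqn A s t ε ⟩ ⊢ deqn A s t δ
    ax-one   : ∀ A s t → ∅ ⊢ deqn A s t one
    ax-inf   : ∀ A s t {I : Set} (ε : I → UI 0ℓ)
             → (λ g → ∃ λ i → g ≡ deqn A s t (ε i)) ⊢ deqn A s t (inf ε)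
    ax-eq-deqnˡ : ∀ A s t u ε → ⟨ eqn A s t ⟩ ∪ ⟨ deqn A t u ε ⟩ ⊢ deqn A s u ε
    ax-eq-deqnʳ : ∀ A s t u ε → ⟨ eqn A s t ⟩ ∪ ⟨ deqn A u s ε ⟩ ⊢ deqn A u t ε
    ax-horn  : ∀ A h → ℋ h → (σ : Fin (nvars h) → Term Sg (Car A))
             → (λ g → ∃ λ i → g ≡ atomGEq A σ (prem h i)) ⊢ atomGEq A σ (concl h)

  -- The construction F(A, d_A): Terms(A)/≡ presented as a setoid.
  --   s ≡ t      iff  Φ ⊢ ∀(A,d_A). s = t
  --   Δ(s,t)     =    inf { ε ∈ [0,1] | Φ ⊢ ∀(A,d_A). s =_ε t }
  --   op^F       =    op  (on representatives)

  Δ : PSet → (A : GMetSpace) → Term Sg (Car A) → Term Sg (Car A) → UI (lsuc (lsuc 0ℓ))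
  Δ Φ A s t = inf {I = Σ (UI 0ℓ) (λ ε → Φ ⊢ deqn A s t ε)} proj₁

  F : PSet → GMetSpace → QAlg (lsuc (lsuc 0ℓ))
  F Φ A = record
    { struct = record
        { Carrier = Term Sg (Car A)
        ; _≈_     = λ s t → Φ ⊢ eqn A s t
        ; dist    = Δ Φ A
        }
    ; ops = op
    }

-- Every ε with Φ ⊢ s =_ε t bounds Δ(s,t) from above, and conversely, by the
-- infimum rule (i) together with monotonicity (g), Φ ⊢ s =_{Δ(s,t)} t: the
-- distance of F(A) is attained by a derivation. Hence satisfaction of an
-- atomic statement in F(A) is the same as its derivability from Φ, and the
-- Horn rule (k) makes F(A) a GMet space. For an axiom of Φ and a nonexpansive
-- τ : X → F(A), the interpretation ⟦ s ⟧τ is provably equal to the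
-- substitution instance τ(s), whose equations follow from Φ by rule (e),
-- the premises of (e) being exactly nonexpansiveness of τ.
module Submission where

open import Defs
open import Level using (lift; 0ℓ)
open import Data.Product using (Σ; ∃; _×_; _,_; proj₁; proj₂)
open import Data.Sum using (inj₁; inj₂)
open import Data.Fin using (Fin)
open import Relation.Binary.PropositionalEquality using (_≡_; refl)

module _ (Sg : Signature) (ℋ : Horn → Set) where
  open Theory Sg ℋ

  infix 3 _⊢*_

  _⊢*_ : PSet → PSet → Set₂
  Φ ⊢* Ψ = ∀ ψ → Ψ ψ → Φ ⊢ ψ

  ⊢*-∅ : ∀ {Φ} → Φ ⊢* ∅
  ⊢*-∅ _ (lift ())

  ⊢*-⟨⟩ : ∀ {Φ e} → Φ ⊢ e → Φ ⊢* ⟨ e ⟩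
  ⊢*-⟨⟩ d _ refl = d

  ⊢*-∪ : ∀ {Φ Ψ Ψ'} → Φ ⊢* Ψ → Φ ⊢* Ψ' → Φ ⊢* Ψ ∪ Ψ'
  ⊢*-∪ d d' _ (inj₁ p) = d _ p
  ⊢*-∪ d d' _ (inj₂ p) = d' _ p

  cut : ∀ {Φ Ψ ψ} → Ψ ⊢ ψ → Φ ⊢* Ψ → Φ ⊢ ψ
  cut r h = CUT h (WEAKENING r (λ _ → inj₂))

  module _ {Φ : PSet} {A : GMetSpace} where

    ⊢-sym : ∀ {s t} → Φ ⊢ eqn A s t → Φ ⊢ eqn A t s
    ⊢-sym {s} {t} d = cut (ax-sym A s t) (⊢*-⟨⟩ d)

    ⊢-trans : ∀ {s t u} → Φ ⊢ eqn A s t → Φ ⊢ eqn A t u → Φ ⊢ eqn A s u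
    ⊢-trans {s} {t} {u} d e = cut (ax-trans A s t u) (⊢*-∪ (⊢*-⟨⟩ d) (⊢*-⟨⟩ e))

    ⊢-deqn-resp-eqn : ∀ {s s' t t' ε} → Φ ⊢ eqn A s s' → Φ ⊢ eqn A t t'
                    → Φ ⊢ deqn A s t ε → Φ ⊢ deqn A s' t' ε
    ⊢-deqn-resp-eqn {s} {s'} {t} {t'} {ε} s≡s' t≡t' d =
      cut (ax-eq-deqnʳ A t t' s' ε) (⊢*-∪ (⊢*-⟨⟩ t≡t') (⊢*-⟨⟩ d'))
      where
      d' : Φ ⊢ deqn A s' t ε
      d' = cut (ax-eq-deqnˡ A s' s t ε) (⊢*-∪ (⊢*-⟨⟩ (⊢-sym s≡s')) (⊢*-⟨⟩ d))

    ⊢⇒Δ≼ : ∀ {s t ε} → Φ ⊢ deqn A s t ε → Δ Φ A s t ≼ ε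
    ⊢⇒Δ≼ {ε = ε} d _ u = inj₂ ((ε , d) , u)

    Δ-upper-witness : ∀ {s t q} → Up (Δ Φ A s t) q
                    → Σ (UI 0ℓ) λ ε → Φ ⊢ deqn A s t ε × Up ε q
    Δ-upper-witness {s} {t} (inj₁ (lift 1<q)) = one , cut (ax-one A s t) ⊢*-∅ , 1<q
    Δ-upper-witness (inj₂ ((ε , d) , u))      = ε , d , u

    -- The family is indexed by the rationals above ε, each contributing a
    -- derivable bound below that rational; its infimum is therefore ≤ ε.
    Δ≼⇒⊢ : ∀ {s t ε} → Δ Φ A s t ≼ ε → Φ ⊢ deqn A s t ε
    Δ≼⇒⊢ {s} {t} {ε} Δ≼ε =
      cut (ax-mono A s t (inf bound) ε inf≼ε)
          (⊢*-⟨⟩ (cut (ax-inf A s t bound) bounds-derivable))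
      where
      Above : Set
      Above = Σ _ (Up ε)

      witness : (q : Above) → Σ (UI 0ℓ) λ e → Φ ⊢ deqn A s t e × Up e (proj₁ q)
      witness (q , u) = Δ-upper-witness (Δ≼ε q u)

      bound : Above → UI 0ℓ
      bound q = proj₁ (witness q)

      bounds-derivable : Φ ⊢* λ g → ∃ λ q → g ≡ deqn A s t (bound q)
      bounds-derivable _ (q , refl) = proj₁ (proj₂ (witness q))

      inf≼ε : inf bound ≼ ε
      inf≼ε q u = inj₂ ((q , u) , proj₂ (proj₂ (witness (q , u))))

    ⟦⟧≈bind : ∀ {X : Set} (s : Term Sg X) (τ : X → Term Sg (Car A))
            → Φ ⊢ eqn A (⟦_⟧ {𝔸 = F Φ A} s τ) (bind τ s)
    ⟦⟧≈bind (var x)   τ = cut (ax-refl A (τ x)) ⊢*-∅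
    ⟦⟧≈bind (op o ts) τ = cut (ax-cong A o _ _) λ { _ (i , refl) → ⟦⟧≈bind (ts i) τ }

    SatAtom⇔⊢ : ∀ {m} (v : Fin m → Term Sg (Car A)) (a : Atom m)
              → (SatAtom (struct (F Φ A)) v a → Φ ⊢ atomGEq A v a)
              × (Φ ⊢ atomGEq A v a → SatAtom (struct (F Φ A)) v a)
    SatAtom⇔⊢ v (x ≐ y)     = (λ p → p) , (λ p → p)
    SatAtom⇔⊢ v (dle x y ε) = Δ≼⇒⊢ , ⊢⇒Δ≼

    F-isGMet : IsGMet (struct (F Φ A))
    F-isGMet h h∈ℋ v sat-prems =
      proj₂ (SatAtom⇔⊢ v (concl h))
        (cut (ax-horn A h h∈ℋ v) λ { _ (i , refl) → proj₁ (SatAtom⇔⊢ v (prem h i)) (sat-prems i) })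

    nonexp⇒⊢-subst-premises : ∀ {X} (τ : Car X → Term Sg (Car A))
      → Nonexp (spc X) (struct (F Φ A)) τ
      → Φ ⊢* λ g → ∃ λ a → ∃ λ a' → g ≡ deqn A (τ a) (τ a') (d X a a')
    nonexp⇒⊢-subst-premises τ ne _ (a , a' , refl) = Δ≼⇒⊢ (ne a a')

    F-models : Models (F Φ A) Φ
    F-models (eqn X s t) s≡t∈Φ τ ne =
      ⊢-trans (⟦⟧≈bind s τ) (⊢-trans τs≡τt (⊢-sym (⟦⟧≈bind t τ)))
      where
      τs≡τt : Φ ⊢ eqn A (bind τ s) (bind τ t)
      τs≡τt = cut (ax-subst-eq X A τ s t)
                  (⊢*-∪ (nonexp⇒⊢-subst-premises {X} τ ne) (⊢*-⟨⟩ (INIT s≡t∈Φ)))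
    F-models (deqn X s t ε) s≡εt∈Φ τ ne =
      ⊢⇒Δ≼ (⊢-deqn-resp-eqn (⊢-sym (⟦⟧≈bind s τ)) (⊢-sym (⟦⟧≈bind t τ)) τs≡ετt)
      where
      τs≡ετt : Φ ⊢ deqn A (bind τ s) (bind τ t) ε
      τs≡ετt = cut (ax-subst-deq X A τ s t ε)
                   (⊢*-∪ (nonexp⇒⊢-subst-premises {X} τ ne) (⊢*-⟨⟩ (INIT s≡εt∈Φ)))

mainTheorem4 : (Sg : Signature) (ℋ : Horn → Set)
    → let open Theory Sg ℋ in
      (Φ : PSet) (A : GMetSpace) → Term Sg (Car A)
    → IsGMet (struct (F Φ A)) × Models (F Φ A) Φ
mainTheorem4 Sg ℋ Φ A _ = F-isGMet Sg ℋ {Φ} {A} , F-models Sg ℋ {Φ} {A}
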